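{- Let $\varphi,\psi\in\mathrm{Fm}_{\mathsf S}$ and $a,b\in Ag$ with $a\neq b$. Then: (1) $\vdash_{\mathsf S}B_aK_b\psi\lor I_aK_b\psi\to\neg S_{a,b}(\varphi\to\psi)$; (2) $\vdash_{\mathsf S}B_aK_b\neg\varphi\lor I_aK_b\neg\varphi\to\neg S_{a,b}(\varphi\to\psi)$.
   Context: Let $Ag$ be a non-empty finite set of agents and $Var$ a countably infinite set of propositional variables. The formulas $\mathrm{Fm}_{\mathsf S}$ are generated by $\varphi::=p\mid\neg\varphi\mid\varphi\land\varphi\mid I_a\varphi\mid K_a\varphi\mid B_a\varphi$ ($p\in Var$, $a\in Ag$), with $\lor,\to$ classical abbreviations. The logic $\mathsf S$ ($\vdash_{\mathsf S}\varphi$ means $\varphi$ is derivable) has as axioms: all classical tautologies; for each $a$ and $\star\in\{K_a,B_a,I_a\}$, $\star(\varphi\to\psi)\to(\star\varphi\to\star\psi)$; $K_a\varphi\to\varphi$; $K_a\varphi\to K_aK_a\varphi$; $B_a\varphi\to\neg B_a\neg\varphi$; $K_a\varphi\to B_a\varphi$; $B_a\varphi\to K_aB_a\varphi$; $I_a\varphi\to\neg I_a\neg\varphi$; $I_a\varphi\to K_aI_a\varphi$; $I_a\varphi\to I_aK_a\varphi$; $I_a\varphi\to I_aI_a\varphi$; rules: modus ponens and necessitation for each $K_a,B_a,I_a$. $S_{a,b}\varphi:=K_a\varphi\land B_a\neg K_b\varphi\land I_a(\varphi\land\neg K_b\varphi)$. -}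

module Defs where

open import Data.Nat using (ℕ; suc)
open import Data.Fin using (Fin)
open import Data.Bool using (Bool; true; false; not; _∧_)
open import Relation.Binary.PropositionalEquality using (_≡_)

-- Formulas over agents Fin n (Ag non-empty finite: n = suc m) and Var = ℕ
-- (countably infinite).
data Fm (n : ℕ) : Set where
  var  : ℕ → Fm n
  ¬'_  : Fm n → Fm n
  _∧'_ : Fm n → Fm n → Fm n
  I K B : Fin n → Fm n → Fm n

infixr 6 _∧'_
infixr 5 _∨'_
infixr 4 _⇒_
infix 7 ¬'_

_∨'_ : ∀ {n} → Fm n → Fm n → Fm n
φ ∨' ψ = ¬' (¬' φ ∧' ¬' ψ)

_⇒_ : ∀ {n} → Fm n → Fm n → Fm n
φ ⇒ ψ = ¬' (φ ∧' ¬' ψ)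

eval : ∀ {n} → (Fm n → Bool) → Fm n → Bool
eval v (var p) = v (var p)
eval v (¬' φ) = not (eval v φ)
eval v (φ ∧' ψ) = eval v φ ∧ eval v ψ
eval v (I a φ) = v (I a φ)
eval v (K a φ) = v (K a φ)
eval v (B a φ) = v (B a φ)

-- Classical tautologies (substitution instances of propositional tautologies).
Tautology : ∀ {n} → Fm n → Set
Tautology φ = ∀ v → eval v φ ≡ true

data ⊢S_ {n : ℕ} : Fm n → Set where
  taut : ∀ {φ} → Tautology φ → ⊢S φ
  K-I  : ∀ a φ ψ → ⊢S (I a (φ ⇒ ψ) ⇒ (I a φ ⇒ I a ψ))
  K-K  : ∀ a φ ψ → ⊢S (K a (φ ⇒ ψ) ⇒ (K a φ ⇒ K a ψ))
  K-B  : ∀ a φ ψ → ⊢S (B a (φ ⇒ ψ) ⇒ (B a φ ⇒ B a ψ))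
  T-K  : ∀ a φ → ⊢S (K a φ ⇒ φ)
  4-K  : ∀ a φ → ⊢S (K a φ ⇒ K a (K a φ))
  D-B  : ∀ a φ → ⊢S (B a φ ⇒ ¬' B a (¬' φ))
  KB   : ∀ a φ → ⊢S (K a φ ⇒ B a φ)
  BKB  : ∀ a φ → ⊢S (B a φ ⇒ K a (B a φ))
  D-I  : ∀ a φ → ⊢S (I a φ ⇒ ¬' I a (¬' φ))
  IKI  : ∀ a φ → ⊢S (I a φ ⇒ K a (I a φ))
  IIK  : ∀ a φ → ⊢S (I a φ ⇒ I a (K a φ))
  III  : ∀ a φ → ⊢S (I a φ ⇒ I a (I a φ))
  mp   : ∀ {φ ψ} → ⊢S (φ ⇒ ψ) → ⊢S φ → ⊢S ψ
  nec-K : ∀ a {φ} → ⊢S φ → ⊢S (K a φ)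
  nec-B : ∀ a {φ} → ⊢S φ → ⊢S (B a φ)
  nec-I : ∀ a {φ} → ⊢S φ → ⊢S (I a φ)

infix 2 ⊢S_

S : ∀ {n} → Fin n → Fin n → Fm n → Fm n
S a b φ = K a φ ∧' (B a (¬' K b φ) ∧' I a (φ ∧' ¬' K b φ))

-- Both formulas ψ and ¬φ imply φ → ψ, so it suffices to show that B_a K_b θ and
-- I_a K_b θ each refute S_{a,b} χ whenever ⊢ θ → χ. By monotonicity they give
-- B_a K_b χ resp. I_a K_b χ, while S_{a,b} χ gives B_a ¬K_b χ resp. I_a ¬K_b χ
-- (the latter through I_a (χ ∧ ¬K_b χ)); the D axioms of B_a and I_a forbid both.
module Submission where

open import Defs
open import Data.Bool using (Bool; true; false; not; _∧_; _≟_)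
open import Data.Fin using (Fin; zero; suc)
open import Data.Nat using (ℕ; zero; suc)
open import Data.Product using (_×_; _,_)
open import Data.Vec using (Vec; []; _∷_; lookup; map)
open import Data.Vec.Properties using (lookup-map)
open import Function using (_∘_)
open import Relation.Binary.PropositionalEquality using (_≡_; _≢_; cong; cong₂; sym; trans)
open import Relation.Nullary.Decidable using (Dec; True; toWitness; map′; _×-dec_)
open import Relation.Unary using (Decidable)

module TruthTable where

  infixr 6 _∧ₛ_
  infixr 5 _∨ₛ_
  infixr 4 _⇒ₛ_
  infix 7 ¬ₛ_

  data Schema (k : ℕ) : Set where
    atom : Fin k → Schema k
    ¬ₛ_  : Schema k → Schema k
    _∧ₛ_ : Schema k → Schema k → Schema k

  p₀ : ∀ {k} → Schema (suc k)
  p₀ = atom zero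

  p₁ : ∀ {k} → Schema (suc (suc k))
  p₁ = atom (suc zero)

  p₂ : ∀ {k} → Schema (suc (suc (suc k)))
  p₂ = atom (suc (suc zero))

  _∨ₛ_ _⇒ₛ_ : ∀ {k} → Schema k → Schema k → Schema k
  s ∨ₛ t = ¬ₛ (¬ₛ s ∧ₛ ¬ₛ t)
  s ⇒ₛ t = ¬ₛ (s ∧ₛ ¬ₛ t)

  ⟦_⟧ : ∀ {k} → Schema k → Vec Bool k → Bool
  ⟦ atom i ⟧ ρ = lookup ρ i
  ⟦ ¬ₛ s ⟧   ρ = not (⟦ s ⟧ ρ)
  ⟦ s ∧ₛ t ⟧ ρ = ⟦ s ⟧ ρ ∧ ⟦ t ⟧ ρ

  instantiate : ∀ {k n} → Schema k → Vec (Fm n) k → Fm n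
  instantiate (atom i) σ = lookup σ i
  instantiate (¬ₛ s)   σ = ¬' instantiate s σ
  instantiate (s ∧ₛ t) σ = instantiate s σ ∧' instantiate t σ

  eval-instantiate : ∀ {k n} (v : Fm n → Bool) (s : Schema k) (σ : Vec (Fm n) k) →
                     eval v (instantiate s σ) ≡ ⟦ s ⟧ (map (eval v) σ)
  eval-instantiate v (atom i) σ = sym (lookup-map i (eval v) σ)
  eval-instantiate v (¬ₛ s)   σ = cong not (eval-instantiate v s σ)
  eval-instantiate v (s ∧ₛ t) σ = cong₂ _∧_ (eval-instantiate v s σ) (eval-instantiate v t σ)

  Valid : ∀ {k} → Schema k → Set
  Valid s = ∀ ρ → ⟦ s ⟧ ρ ≡ true

  ∀-valuation? : ∀ {k} {P : Vec Bool k → Set} → Decidable P → Dec (∀ ρ → P ρ)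
  ∀-valuation? {zero} P? = map′ (λ { p [] → p }) (λ f → f []) (P? [])
  ∀-valuation? {suc k} P? =
    map′ (λ { (t , f) (true ∷ ρ) → t ρ ; (t , f) (false ∷ ρ) → f ρ })
         (λ g → g ∘ (true ∷_) , g ∘ (false ∷_))
         (∀-valuation? (P? ∘ (true ∷_)) ×-dec ∀-valuation? (P? ∘ (false ∷_)))

  valid? : ∀ {k} (s : Schema k) → Dec (Valid s)
  valid? s = ∀-valuation? (λ ρ → ⟦ s ⟧ ρ ≟ true)

  by-truth-table : ∀ {k n} (s : Schema k) {_ : True (valid? s)} (σ : Vec (Fm n) k) →
                   ⊢S instantiate s σ
  by-truth-table s {s-valid} σ =
    taut λ v → trans (eval-instantiate v s σ) (toWitness s-valid (map (eval v) σ))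

open TruthTable

module _ {n : ℕ} where

  ⇒-trans : ∀ {φ ψ χ : Fm n} → ⊢S (φ ⇒ ψ) → ⊢S (ψ ⇒ χ) → ⊢S (φ ⇒ χ)
  ⇒-trans {φ} {ψ} {χ} = mp ∘ mp (by-truth-table
    ((p₀ ⇒ₛ p₁) ⇒ₛ (p₁ ⇒ₛ p₂) ⇒ₛ p₀ ⇒ₛ p₂) (φ ∷ ψ ∷ χ ∷ []))

  contraposition : ∀ {φ ψ : Fm n} → ⊢S (φ ⇒ ψ) → ⊢S (¬' ψ ⇒ ¬' φ)
  contraposition {φ} {ψ} = mp (by-truth-table
    ((p₀ ⇒ₛ p₁) ⇒ₛ ¬ₛ p₁ ⇒ₛ ¬ₛ p₀) (φ ∷ ψ ∷ []))

  ∨-elim : ∀ {φ ψ χ : Fm n} → ⊢S (φ ⇒ χ) → ⊢S (ψ ⇒ χ) → ⊢S (φ ∨' ψ ⇒ χ)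
  ∨-elim {φ} {ψ} {χ} = mp ∘ mp (by-truth-table
    ((p₀ ⇒ₛ p₂) ⇒ₛ (p₁ ⇒ₛ p₂) ⇒ₛ p₀ ∨ₛ p₁ ⇒ₛ p₂) (φ ∷ ψ ∷ χ ∷ []))

  record IsNormal (□ : Fm n → Fm n) : Set where
    field
      distrib       : ∀ φ ψ → ⊢S (□ (φ ⇒ ψ) ⇒ (□ φ ⇒ □ ψ))
      necessitation : ∀ {φ} → ⊢S φ → ⊢S □ φ

    mono : ∀ {φ ψ} → ⊢S (φ ⇒ ψ) → ⊢S (□ φ ⇒ □ ψ)
    mono {φ} {ψ} = mp (distrib φ ψ) ∘ necessitation

  record IsKD (□ : Fm n → Fm n) : Set where
    field
      isNormal  : IsNormal □
      seriality : ∀ φ → ⊢S (□ φ ⇒ ¬' □ (¬' φ))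

    open IsNormal isNormal public

    □-excludes : ∀ {θ χ ξ} → ⊢S (θ ⇒ χ) → ⊢S (ξ ⇒ □ (¬' χ)) → ⊢S (□ θ ⇒ ¬' ξ)
    □-excludes {χ = χ} θ⇒χ ξ⇒□¬χ =
      ⇒-trans (mono θ⇒χ) (⇒-trans (seriality χ) (contraposition ξ⇒□¬χ))

  K-normal : (a : Fin n) → IsNormal (K a)
  K-normal a = record { distrib = K-K a ; necessitation = nec-K a }

  B-KD : (a : Fin n) → IsKD (B a)
  B-KD a = record
    { isNormal  = record { distrib = K-B a ; necessitation = nec-B a }
    ; seriality = D-B a
    }

  I-KD : (a : Fin n) → IsKD (I a)
  I-KD a = record
    { isNormal  = record { distrib = K-I a ; necessitation = nec-I a }
    ; seriality = D-I a
    }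

  module _ (a b : Fin n) (χ : Fm n) where

    S⇒B¬K : ⊢S (S a b χ ⇒ B a (¬' K b χ))
    S⇒B¬K = by-truth-table (p₀ ∧ₛ p₁ ∧ₛ p₂ ⇒ₛ p₁)
      (K a χ ∷ B a (¬' K b χ) ∷ I a (χ ∧' ¬' K b χ) ∷ [])

    S⇒I¬K : ⊢S (S a b χ ⇒ I a (¬' K b χ))
    S⇒I¬K = ⇒-trans
      (by-truth-table (p₀ ∧ₛ p₁ ∧ₛ p₂ ⇒ₛ p₂)
        (K a χ ∷ B a (¬' K b χ) ∷ I a (χ ∧' ¬' K b χ) ∷ []))
      (IsKD.mono (I-KD a) (by-truth-table (p₀ ∧ₛ p₁ ⇒ₛ p₁) (χ ∷ ¬' K b χ ∷ [])))

  B∨I-K⇒¬S : ∀ (a b : Fin n) {θ χ : Fm n} → ⊢S (θ ⇒ χ) →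
             ⊢S (B a (K b θ) ∨' I a (K b θ) ⇒ ¬' S a b χ)
  B∨I-K⇒¬S a b {θ} {χ} θ⇒χ = ∨-elim
    (IsKD.□-excludes (B-KD a) Kθ⇒Kχ (S⇒B¬K a b χ))
    (IsKD.□-excludes (I-KD a) Kθ⇒Kχ (S⇒I¬K a b χ))
    where
    Kθ⇒Kχ : ⊢S (K b θ ⇒ K b χ)
    Kθ⇒Kχ = IsNormal.mono (K-normal b) θ⇒χ

proposition8 : ∀ {m : ℕ} (φ ψ : Fm (suc m)) (a b : Fin (suc m)) → a ≢ b →
    (⊢S (B a (K b ψ) ∨' I a (K b ψ) ⇒ ¬' S a b (φ ⇒ ψ)))
    × (⊢S (B a (K b (¬' φ)) ∨' I a (K b (¬' φ)) ⇒ ¬' S a b (φ ⇒ ψ)))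
proposition8 φ ψ a b _ =
    B∨I-K⇒¬S a b (by-truth-table (p₁ ⇒ₛ p₀ ⇒ₛ p₁) (φ ∷ ψ ∷ []))
  , B∨I-K⇒¬S a b (by-truth-table (¬ₛ p₀ ⇒ₛ p₀ ⇒ₛ p₁) (φ ∷ ψ ∷ []))
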